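{- For any formulae $A, C$ and any derivation $f : A \Rightarrow C$ in the skew monoidal categorical calculus, there exists a unique focused derivation $h$ of $A \mid\ \vdash_{\mathsf L} C$ (stoup $A$, empty context) such that $f \doteq \mathrm{sound}(\mathrm{emb}_{\mathsf L}\, h)$. Equivalently, letting $\mathrm{focderivs}(A, (), C)$ be the finite duplicate-free list of all focused derivations of $A \mid\ \vdash_{\mathsf L} C$, the list $[\mathrm{sound}(\mathrm{emb}_{\mathsf L}\, h) \mid h \in \mathrm{focderivs}(A,(),C)]$ contains, for every $f : A \Rightarrow C$, exactly one entry $\doteq$-equivalent to $f$.
   Context: Fix a set $\mathrm{Var}$ of atoms. Formulae: atoms $X \in \mathrm{Var}$, $\mathsf{I}$, and $A \otimes B$. A context is a finite list of formulae; a stoup $S$ is either empty ($-$) or a single formula; a stoup $T$ is irreducible if $T = -$ or $T$ is an atom. Categorical calculus: judgements $A \Rightarrow C$ derived by $\mathrm{id}_A : A \Rightarrow A$; $g \circ f : A \Rightarrow C$ from $f : A \Rightarrow B$, $g : B \Rightarrow C$; $f \otimes g : A \otimes B \Rightarrow C \otimes D$ from $f : A \Rightarrow C$, $g : B \Rightarrow D$; axioms $\lambda_A : \mathsf{I} \otimes A \Rightarrow A$, $\rho_A : A \Rightarrow A \otimes \mathsf{I}$, $\alpha_{A,B,C} : (A \otimes B) \otimes C \Rightarrow A \otimes (B \otimes C)$. The relation $\doteq$ is the least congruence (w.r.t. $\circ$ and $\otimes$) containing: $f \circ \mathrm{id} \doteq f \doteq \mathrm{id} \circ f$; $h \circ (g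 \circ f) \doteq (h \circ g) \circ f$; $\mathrm{id}_A \otimes \mathrm{id}_B \doteq \mathrm{id}_{A \otimes B}$; $(h \circ f) \otimes (k \circ g) \doteq (h \otimes k) \circ (f \otimes g)$; $\lambda_B \circ (\mathrm{id}_{\mathsf I} \otimes f) \doteq f \circ \lambda_A$; $(f \otimes \mathrm{id}_{\mathsf I}) \circ \rho_A \doteq \rho_B \circ f$; $(f \otimes (g \otimes h)) \circ \alpha \doteq \alpha \circ ((f \otimes g) \otimes h)$; $\lambda_{\mathsf I} \circ \rho_{\mathsf I} \doteq \mathrm{id}_{\mathsf I}$; $(\mathrm{id}_A \otimes \lambda_B) \circ \alpha_{A,\mathsf I,B} \circ (\rho_A \otimes \mathrm{id}_B) \doteq \mathrm{id}_{A \otimes B}$; $\lambda_{A \otimes B} \circ \alpha_{\mathsf I,A,B} \doteq \lambda_A \otimes \mathrm{id}_B$; $\alpha_{A,B,\mathsf I} \circ \rho_{A \otimes B} \doteq \mathrm{id}_A \otimes \rho_B$; $\alpha_{A,B,C \otimes D} \circ \alpha_{A \otimes B,C,D} \doteq (\mathrm{id}_A \otimes \alpha_{B,C,D}) \circ \alpha_{A,B \otimes C,D} \circ (\alpha_{A,B,C} \otimes \mathrm{id}_D)$. ($\doteq$-classes are morphisms of the free skew monoidal category on $\mathrm{Var}$.) Cut-free sequent calculus: sequents $S \mid \Gamma \vdash C$ derived by (ax) $A \mid\ \vdash A$; (pass) from $A \mid \Gamma \vdash C$ infer $- \mid A, \Gamma \vdash C$; ($\mathsf I$L) from $- \mid \Gamma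 \vdash C$ infer $\mathsf I \mid \Gamma \vdash C$; ($\mathsf I$R) $- \mid\ \vdash \mathsf I$; ($\otimes$L) from $A \mid B, \Gamma \vdash C$ infer $A \otimes B \mid \Gamma \vdash C$; ($\otimes$R) from $S \mid \Gamma \vdash A$ and $- \mid \Delta \vdash B$ infer $S \mid \Gamma, \Delta \vdash A \otimes B$. Focused calculus: sequents $S \mid \Gamma \vdash_{\mathsf L} C$ and $T \mid \Gamma \vdash_{\mathsf R} C$ ($T$ irreducible), derived by: (pass) from $A \mid \Gamma \vdash_{\mathsf L} C$ infer $- \mid A, \Gamma \vdash_{\mathsf L} C$; (switch) from $T \mid \Gamma \vdash_{\mathsf R} C$ infer $T \mid \Gamma \vdash_{\mathsf L} C$; (ax$_X$) $X \mid\ \vdash_{\mathsf R} X$ for atoms $X$; ($\mathsf I$L) from $- \mid \Gamma \vdash_{\mathsf L} C$ infer $\mathsf I \mid \Gamma \vdash_{\mathsf L} C$; ($\mathsf I$R$_{\mathsf R}$) $- \mid\ \vdash_{\mathsf R} \mathsf I$; ($\otimes$L) from $A \mid B, \Gamma \vdash_{\mathsf L} C$ infer $A \otimes B \mid \Gamma \vdash_{\mathsf L} C$; ($\otimes$R$_{\mathsf R}$) from $T \mid \Gamma \vdash_{\mathsf R} A$ and $- \mid \Delta \vdash_{\mathsf L} B$ infer $T \mid \Gamma, \Delta \vdash_{\mathsf R} A \otimes B$. $\mathrm{emb}_{\mathsf L}$ maps a focused derivation to a cut-free derivation of the same sequent (phase erased) by deleting switch steps and replacing each focused rule by the unfocused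 rule of the same name. Interpretation: $\llbracket - \rrbracket = \mathsf I$, $\llbracket A \rrbracket = A$; $\llbracket S \mid A_1,\dots,A_n \rrbracket = (\cdots(\llbracket S \rrbracket \otimes A_1)\cdots) \otimes A_n$. For $f : A \Rightarrow B$: $\llbracket f \mid () \rrbracket = f$, $\llbracket f \mid C, \Gamma \rrbracket = \llbracket f \otimes \mathrm{id}_C \mid \Gamma \rrbracket$. Define $\psi_{A,B,()} = \mathrm{id}_{A \otimes B}$, $\psi_{A,B,(C,\Gamma)} = \psi_{A,B \otimes C,\Gamma} \circ \llbracket \alpha_{A,B,C} \mid \Gamma \rrbracket$; $\varphi'_{A,(),\Delta} = \psi_{A,\mathsf I,\Delta} \circ \llbracket \rho_A \mid \Delta \rrbracket$, $\varphi'_{A,(C,\Gamma),\Delta} = \varphi'_{A \otimes C,\Gamma,\Delta}$, $\varphi_{S,\Gamma,\Delta} = \varphi'_{\llbracket S \rrbracket,\Gamma,\Delta}$. The translation $\mathrm{sound}$ from cut-free derivations of $S \mid \Gamma \vdash C$ to derivations $\llbracket S \mid \Gamma \rrbracket \Rightarrow C$: $\mathrm{sound}(\mathrm{ax}_C) = \mathrm{id}_C$; $\mathrm{sound}(\mathrm{pass}\, f) = \mathrm{sound}\, f \circ \llbracket \lambda_A \mid \Gamma' \rrbracket$ for $f : A \mid \Gamma' \vdash C$; $\mathrm{sound}(\mathsf I\mathrm L\, f) = \mathrm{sound}\, f$; $\mathrm{sound}(\otimes\mathrm L\, f) = \mathrm{sound}\, f$; $\mathrm{sound}(\mathsf I\mathrm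 R) = \mathrm{id}_{\mathsf I}$; $\mathrm{sound}(\otimes\mathrm R(f_1, f_2)) = (\mathrm{sound}\, f_1 \otimes \mathrm{sound}\, f_2) \circ \varphi_{S,\Gamma_1,\Gamma_2}$ for $f_1 : S \mid \Gamma_1 \vdash C_1$, $f_2 : - \mid \Gamma_2 \vdash C_2$. -}

module Defs where

open import Data.List using (List; []; _∷_; _++_)

data Fma (At : Set) : Set where
  atom : At → Fma At
  I    : Fma At
  _⊗_  : Fma At → Fma At → Fma At

infixl 22 _⊗_

Cxt : Set → Set
Cxt At = List (Fma At)

data Stp (At : Set) : Set where
  ─  : Stp At
  `_ : Fma At → Stp At

data Irr (At : Set) : Set where
  ─  : Irr At
  at : At → Irr At

irr : {At : Set} → Irr At → Stp At
irr ─      = ─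
irr (at X) = ` atom X

infix 15 _⇒_
infixr 20 _∘_
infixl 21 _⊗ₘ_

data _⇒_ {At : Set} : Fma At → Fma At → Set where
  id   : {A : Fma At} → A ⇒ A
  _∘_  : {A B C : Fma At} → B ⇒ C → A ⇒ B → A ⇒ C
  _⊗ₘ_ : {A B C D : Fma At} → A ⇒ C → B ⇒ D → A ⊗ B ⇒ C ⊗ D
  l    : {A : Fma At} → I ⊗ A ⇒ A
  ρ    : {A : Fma At} → A ⇒ A ⊗ I
  α    : {A B C : Fma At} → (A ⊗ B) ⊗ C ⇒ A ⊗ (B ⊗ C)

infix 15 _≐_

data _≐_ {At : Set} : {A B : Fma At} → A ⇒ B → A ⇒ B → Set where
  refl   : {A B : Fma At} {f : A ⇒ B} → f ≐ f
  ~_     : {A B : Fma At} {f g : A ⇒ B} → f ≐ g → g ≐ f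
  _∙_    : {A B : Fma At} {f g h : A ⇒ B} → f ≐ g → g ≐ h → f ≐ h
  _∘_    : {A B C : Fma At} {f g : B ⇒ C} {h k : A ⇒ B} →
           f ≐ g → h ≐ k → f ∘ h ≐ g ∘ k
  _⊗_    : {A B C D : Fma At} {f g : A ⇒ C} {h k : B ⇒ D} →
           f ≐ g → h ≐ k → f ⊗ₘ h ≐ g ⊗ₘ k
  lid    : {A B : Fma At} {f : A ⇒ B} → f ∘ id ≐ f
  rid    : {A B : Fma At} {f : A ⇒ B} → f ≐ id ∘ f
  ass    : {A B C D : Fma At} {f : A ⇒ B} {g : B ⇒ C} {h : C ⇒ D} →
           h ∘ (g ∘ f) ≐ (h ∘ g) ∘ f
  f⊗id   : {A B : Fma At} → id {A = A} ⊗ₘ id {A = B} ≐ id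
  f⊗∘    : {A B C D E F : Fma At} {f : A ⇒ C} {g : B ⇒ D} {h : C ⇒ E} {k : D ⇒ F} →
           (h ∘ f) ⊗ₘ (k ∘ g) ≐ (h ⊗ₘ k) ∘ (f ⊗ₘ g)
  nl     : {A B : Fma At} {f : A ⇒ B} → l ∘ (id ⊗ₘ f) ≐ f ∘ l
  nρ     : {A B : Fma At} {f : A ⇒ B} → (f ⊗ₘ id) ∘ ρ ≐ ρ ∘ f
  nα     : {A B C D E F : Fma At} {f : A ⇒ D} {g : B ⇒ E} {h : C ⇒ F} →
           (f ⊗ₘ (g ⊗ₘ h)) ∘ α ≐ α ∘ ((f ⊗ₘ g) ⊗ₘ h)
  lρ     : l ∘ ρ ≐ id {A = I}
  lαρ    : {A B : Fma At} →
           (id ⊗ₘ l) ∘ α ∘ (ρ ⊗ₘ id) ≐ id {A = A ⊗ B}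
  lα     : {A B : Fma At} → l ∘ α ≐ l {A = A} ⊗ₘ id {A = B}
  αρ     : {A B : Fma At} → α ∘ ρ ≐ id {A = A} ⊗ₘ ρ {A = B}
  ααα    : {A B C D : Fma At} →
           α ∘ α ≐ (id {A = A} ⊗ₘ α {A = B} {C} {D}) ∘ α ∘ (α ⊗ₘ id)

infix 10 _∣_⊢_

data _∣_⊢_ {At : Set} : Stp At → Cxt At → Fma At → Set where
  ax   : {A : Fma At} → ` A ∣ [] ⊢ A
  pass : {Γ : Cxt At} {A C : Fma At} → ` A ∣ Γ ⊢ C → ─ ∣ A ∷ Γ ⊢ C
  Il   : {Γ : Cxt At} {C : Fma At} → ─ ∣ Γ ⊢ C → ` I ∣ Γ ⊢ C
  Ir   : ─ ∣ [] ⊢ I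
  ⊗l   : {Γ : Cxt At} {A B C : Fma At} → ` A ∣ B ∷ Γ ⊢ C → ` (A ⊗ B) ∣ Γ ⊢ C
  ⊗r   : {S : Stp At} {Γ Δ : Cxt At} {A B : Fma At} →
         S ∣ Γ ⊢ A → ─ ∣ Δ ⊢ B → S ∣ Γ ++ Δ ⊢ A ⊗ B

infix 10 _∣_⊢L_ _∣_⊢R_

data _∣_⊢L_ {At : Set} : Stp At → Cxt At → Fma At → Set
data _∣_⊢R_ {At : Set} : Irr At → Cxt At → Fma At → Set

data _∣_⊢L_ {At} where
  pass   : {Γ : Cxt At} {A C : Fma At} → ` A ∣ Γ ⊢L C → ─ ∣ A ∷ Γ ⊢L C
  switch : {T : Irr At} {Γ : Cxt At} {C : Fma At} → T ∣ Γ ⊢R C → irr T ∣ Γ ⊢L C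
  Il     : {Γ : Cxt At} {C : Fma At} → ─ ∣ Γ ⊢L C → ` I ∣ Γ ⊢L C
  ⊗l     : {Γ : Cxt At} {A B C : Fma At} → ` A ∣ B ∷ Γ ⊢L C → ` (A ⊗ B) ∣ Γ ⊢L C

data _∣_⊢R_ {At} where
  ax : {X : At} → at X ∣ [] ⊢R atom X
  Ir : ─ ∣ [] ⊢R I
  ⊗r : {T : Irr At} {Γ Δ : Cxt At} {A B : Fma At} →
       T ∣ Γ ⊢R A → ─ ∣ Δ ⊢L B → T ∣ Γ ++ Δ ⊢R A ⊗ B

embL : {At : Set} {S : Stp At} {Γ : Cxt At} {C : Fma At} → S ∣ Γ ⊢L C → S ∣ Γ ⊢ C
embR : {At : Set} {T : Irr At} {Γ : Cxt At} {C : Fma At} → T ∣ Γ ⊢R C → irr T ∣ Γ ⊢ C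
embL (pass f)   = pass (embL f)
embL (switch f) = embR f
embL (Il f)     = Il (embL f)
embL (⊗l f)     = ⊗l (embL f)
embR ax         = ax
embR Ir         = Ir
embR (⊗r f g)   = ⊗r (embR f) (embL g)

t : {At : Set} → Stp At → Fma At
t ─     = I
t (` A) = A

_∣∣_ : {At : Set} → Fma At → Cxt At → Fma At
A ∣∣ []      = A
A ∣∣ (C ∷ Γ) = (A ⊗ C) ∣∣ Γ

⟦_∣_⟧ : {At : Set} → Stp At → Cxt At → Fma At
⟦ S ∣ Γ ⟧ = t S ∣∣ Γ

⟦_∣_⟧ₘ : {At : Set} {A B : Fma At} → A ⇒ B → (Γ : Cxt At) → A ∣∣ Γ ⇒ B ∣∣ Γ
⟦ f ∣ [] ⟧ₘ    = f
⟦ f ∣ C ∷ Γ ⟧ₘ = ⟦ f ⊗ₘ id {A = C} ∣ Γ ⟧ₘ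

ψ : {At : Set} (A B : Fma At) (Γ : Cxt At) → (A ⊗ B) ∣∣ Γ ⇒ A ⊗ (B ∣∣ Γ)
ψ A B []      = id
ψ A B (C ∷ Γ) = ψ A (B ⊗ C) Γ ∘ ⟦ α {A = A} {B} {C} ∣ Γ ⟧ₘ

φ' : {At : Set} (A : Fma At) (Γ Δ : Cxt At) → A ∣∣ (Γ ++ Δ) ⇒ (A ∣∣ Γ) ⊗ (I ∣∣ Δ)
φ' A []      Δ = ψ A I Δ ∘ ⟦ ρ {A = A} ∣ Δ ⟧ₘ
φ' A (C ∷ Γ) Δ = φ' (A ⊗ C) Γ Δ

φ : {At : Set} (S : Stp At) (Γ Δ : Cxt At) → ⟦ S ∣ Γ ++ Δ ⟧ ⇒ ⟦ S ∣ Γ ⟧ ⊗ ⟦ ─ ∣ Δ ⟧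
φ S Γ Δ = φ' (t S) Γ Δ

sound : {At : Set} {S : Stp At} {Γ : Cxt At} {C : Fma At} → S ∣ Γ ⊢ C → ⟦ S ∣ Γ ⟧ ⇒ C
sound ax                         = id
sound (pass {Γ = Γ} {A = A} f)   = sound f ∘ ⟦ l {A = A} ∣ Γ ⟧ₘ
sound (Il f)                     = sound f
sound Ir                         = id
sound (⊗l f)                     = sound f
sound (⊗r {S = S} {Γ = Γ} {Δ = Δ} f g) = (sound f ⊗ₘ sound g) ∘ φ S Γ Δ

-- A morphism f : A ⇒ B acts on focused derivations by postcomposition,
-- post f, defined by recursion on f; it only touches the final
-- right-focused phase, where each generator has an obvious effect
-- (λ consumes an Ir, ρ adds one, α reassociates two ⊗r), and every
-- generating equation of ≐ holds for it on the nose.  Applied to the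
-- focused identity idL A, this gives a focused h with sound h ≐ f.
-- Uniqueness: any focused k of S ∣ Γ ⊢L C is recovered as post (sound k)
-- applied to a canonical derivation of S ∣ Γ ⊢L ⟦ S ∣ Γ ⟧, which for
-- stoup A and empty context is idL A; so ≐-equal soundness forces equality.

module Submission where

open import Defs
open import Data.List using ([]; _∷_; _++_; [_])
open import Data.List.Properties using (++-assoc; ++-identityʳ)
open import Data.Product using (Σ; _×_; _,_)
open import Level using (0ℓ)
open import Relation.Binary.Bundles using (Setoid)
open import Relation.Binary.PropositionalEquality
  using (_≡_; refl; sym; trans; cong; cong₂; module ≡-Reasoning)
open import Relation.Binary.PropositionalEquality.Properties using (sym-cong)
import Relation.Binary.Reasoning.Setoid as SetoidReasoning

private variable
  At : Set
  A A' B B' C D : Fma At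
  S : Stp At
  T : Irr At
  Γ Γ' Γ₀ Δ Δ' : Cxt At

castL : Γ ≡ Γ' → S ∣ Γ ⊢L C → S ∣ Γ' ⊢L C
castL refl k = k

castR : Γ ≡ Γ' → T ∣ Γ ⊢R C → T ∣ Γ' ⊢R C
castR refl r = r

infix 4 _≋_
infixr 5 _≋∙_

-- Equality of derivations whose contexts agree only propositionally;
-- it lets casts be ignored without stating how they compose.
data _≋_ {S : Stp At} {Γ : Cxt At} {C : Fma At} (k : S ∣ Γ ⊢L C) :
         {Γ' : Cxt At} → S ∣ Γ' ⊢L C → Set where
  refl≋ : k ≋ k

≋-to-≡ : {k k' : S ∣ Γ ⊢L C} → k ≋ k' → k ≡ k'
≋-to-≡ refl≋ = refl

≡-to-≋ : {k k' : S ∣ Γ ⊢L C} → k ≡ k' → k ≋ k'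
≡-to-≋ refl = refl≋

≋-sym : {k : S ∣ Γ ⊢L C} {k' : S ∣ Γ' ⊢L C} → k ≋ k' → k' ≋ k
≋-sym refl≋ = refl≋

_≋∙_ : {k : S ∣ Γ ⊢L C} {k' : S ∣ Γ' ⊢L C} {k'' : S ∣ Δ ⊢L C} →
       k ≋ k' → k' ≋ k'' → k ≋ k''
refl≋ ≋∙ q = q

castL-≋ : (e : Γ ≡ Γ') (k : S ∣ Γ ⊢L C) → castL e k ≋ k
castL-≋ refl k = refl≋

switch-castR-≋ : (e : Γ ≡ Γ') (r : T ∣ Γ ⊢R C) → switch (castR e r) ≋ switch r
switch-castR-≋ refl r = refl≋

pass-≋ : {k : ` A ∣ Γ ⊢L C} {k' : ` A ∣ Γ' ⊢L C} → k ≋ k' → pass k ≋ pass k'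
pass-≋ refl≋ = refl≋

Il-≋ : {k : ─ ∣ Γ ⊢L C} {k' : ─ ∣ Γ' ⊢L C} → k ≋ k' → Il k ≋ Il k'
Il-≋ refl≋ = refl≋

⊗l-≋ : {k : ` A ∣ B ∷ Γ ⊢L C} {k' : ` A ∣ B ∷ Γ' ⊢L C} → k ≋ k' → ⊗l k ≋ ⊗l k'
⊗l-≋ refl≋ = refl≋

⊗rL : S ∣ Γ ⊢L A → ─ ∣ Δ ⊢L B → S ∣ Γ ++ Δ ⊢L A ⊗ B
⊗rL (pass k)   n = pass (⊗rL k n)
⊗rL (switch r) n = switch (⊗r r n)
⊗rL (Il k)     n = Il (⊗rL k n)
⊗rL (⊗l k)     n = ⊗l (⊗rL k n)

⊗rL-≋ : {k : S ∣ Γ ⊢L A} {k' : S ∣ Γ' ⊢L A} {n : ─ ∣ Δ ⊢L B} {n' : ─ ∣ Δ' ⊢L B} →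
        k ≋ k' → n ≋ n' → ⊗rL k n ≋ ⊗rL k' n'
⊗rL-≋ refl≋ refl≋ = refl≋

idL : (A : Fma At) → ` A ∣ [] ⊢L A
idL (atom X) = switch ax
idL I        = Il (switch Ir)
idL (A ⊗ B)  = ⊗l (⊗rL (idL A) (pass (idL B)))

post  : A ⇒ B → S ∣ Γ ⊢L A → S ∣ Γ ⊢L B
postR : A ⇒ B → T ∣ Γ ⊢R A → irr T ∣ Γ ⊢L B
post f (pass k)   = pass (post f k)
post f (switch r) = postR f r
post f (Il k)     = Il (post f k)
post f (⊗l k)     = ⊗l (post f k)
postR id       r         = switch r
postR (g ∘ f)  r         = post g (postR f r)
postR (f ⊗ₘ g) (⊗r r k)  = ⊗rL (postR f r) (post g k)
postR l        (⊗r Ir k) = k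
postR ρ        r         = switch (castR (++-identityʳ _) (⊗r r (switch Ir)))
postR α        (⊗r {Δ = Γ₃} (⊗r {Γ = Γ₁} {Δ = Γ₂} r k) k') =
  switch (castR (sym (++-assoc Γ₁ Γ₂ Γ₃)) (⊗r r (⊗rL k k')))

post-≋ : (f : A ⇒ B) {k : S ∣ Γ ⊢L A} {k' : S ∣ Γ' ⊢L A} → k ≋ k' → post f k ≋ post f k'
post-≋ f refl≋ = refl≋

-- Postcomposition and the equations of ≐

post-id : (k : S ∣ Γ ⊢L A) → post id k ≡ k
post-id (pass k)   = cong pass (post-id k)
post-id (switch r) = refl
post-id (Il k)     = cong Il (post-id k)
post-id (⊗l k)     = cong ⊗l (post-id k)

post-∘ : (g : B ⇒ C) (f : A ⇒ B) (k : S ∣ Γ ⊢L A) → post (g ∘ f) k ≡ post g (post f k)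
post-∘ g f (pass k)   = cong pass (post-∘ g f k)
post-∘ g f (switch r) = refl
post-∘ g f (Il k)     = cong Il (post-∘ g f k)
post-∘ g f (⊗l k)     = cong ⊗l (post-∘ g f k)

post-⊗rL : (f : A ⇒ A') (g : B ⇒ B') (k : S ∣ Γ ⊢L A) (n : ─ ∣ Δ ⊢L B) →
           post (f ⊗ₘ g) (⊗rL k n) ≡ ⊗rL (post f k) (post g n)
post-⊗rL f g (pass k)   n = cong pass (post-⊗rL f g k n)
post-⊗rL f g (switch r) n = refl
post-⊗rL f g (Il k)     n = cong Il (post-⊗rL f g k n)
post-⊗rL f g (⊗l k)     n = cong ⊗l (post-⊗rL f g k n)

postR-ρ : (r : T ∣ Γ ⊢R A) → postR ρ r ≋ switch (⊗r r (switch Ir))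
postR-ρ {Γ = Γ} r = switch-castR-≋ (++-identityʳ Γ) _

postR-α : (r : T ∣ Γ ⊢R A) (m : ─ ∣ Δ ⊢L B) (n : ─ ∣ Δ' ⊢L C) →
          postR α (⊗r (⊗r r m) n) ≋ switch (⊗r r (⊗rL m n))
postR-α {Γ = Γ} {Δ = Δ} {Δ' = Δ'} r m n = switch-castR-≋ (sym (++-assoc Γ Δ Δ')) _

post-ρ : (k : S ∣ Γ ⊢L A) → post ρ k ≋ ⊗rL k (switch Ir)
post-ρ (pass k)   = pass-≋ (post-ρ k)
post-ρ (switch r) = postR-ρ r
post-ρ (Il k)     = Il-≋ (post-ρ k)
post-ρ (⊗l k)     = ⊗l-≋ (post-ρ k)

post-α : (k : S ∣ Γ ⊢L A) (m : ─ ∣ Δ ⊢L B) (n : ─ ∣ Δ' ⊢L C) →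
         post α (⊗rL (⊗rL k m) n) ≋ ⊗rL k (⊗rL m n)
post-α (pass k)   m n = pass-≋ (post-α k m n)
post-α (switch r) m n = postR-α r m n
post-α (Il k)     m n = Il-≋ (post-α k m n)
post-α (⊗l k)     m n = ⊗l-≋ (post-α k m n)

post-resp-≐  : {f g : A ⇒ B} → f ≐ g → (k : S ∣ Γ ⊢L A) → post f k ≡ post g k
postR-resp-≐ : {f g : A ⇒ B} → f ≐ g → (r : T ∣ Γ ⊢R A) → postR f r ≡ postR g r
post-resp-≐ p (pass k)   = cong pass (post-resp-≐ p k)
post-resp-≐ p (switch r) = postR-resp-≐ p r
post-resp-≐ p (Il k)     = cong Il (post-resp-≐ p k)
post-resp-≐ p (⊗l k)     = cong ⊗l (post-resp-≐ p k)
postR-resp-≐ refl    r = refl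
postR-resp-≐ (~ p)   r = sym (postR-resp-≐ p r)
postR-resp-≐ (p ∙ q) r = trans (postR-resp-≐ p r) (postR-resp-≐ q r)
postR-resp-≐ (_∘_ {f = f} {k = k} p q) r =
  trans (cong (post f) (postR-resp-≐ q r)) (post-resp-≐ p (postR k r))
postR-resp-≐ (p ⊗ q) (⊗r r k) = cong₂ ⊗rL (postR-resp-≐ p r) (post-resp-≐ q k)
postR-resp-≐ lid r = refl
postR-resp-≐ (rid {f = f}) r = sym (post-id (postR f r))
postR-resp-≐ (ass {f = f} {g = g} {h = h}) r = sym (post-∘ h g (postR f r))
postR-resp-≐ f⊗id (⊗r r k) = cong (λ n → switch (⊗r r n)) (post-id k)
postR-resp-≐ (f⊗∘ {f = f} {g = g} {h = h} {k = k}) (⊗r r n) =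
  trans (cong (⊗rL (post h (postR f r))) (post-∘ k g n))
        (sym (post-⊗rL h k (postR f r) (post g n)))
postR-resp-≐ nl (⊗r Ir k) = refl
postR-resp-≐ (nρ {f = f}) r =
  ≋-to-≡ (post-≋ (f ⊗ₘ id) (postR-ρ r) ≋∙ ≋-sym (post-ρ (postR f r)))
postR-resp-≐ (nα {f = f} {g = g} {h = h}) (⊗r (⊗r r k) n) =
  ≋-to-≡ (post-≋ (f ⊗ₘ (g ⊗ₘ h)) (postR-α r k n)
          ≋∙ ≡-to-≋ (cong (⊗rL (postR f r)) (post-⊗rL g h k n))
          ≋∙ ≋-sym (post-α (postR f r) (post g k) (post h n)))
postR-resp-≐ lρ Ir = refl
postR-resp-≐ lαρ (⊗r r k) =
  ≋-to-≡ (post-≋ (id ⊗ₘ l) (post-≋ α (⊗rL-≋ (postR-ρ r) (≡-to-≋ (post-id k)))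
                            ≋∙ post-α (switch r) (switch Ir) k))
postR-resp-≐ lα (⊗r (⊗r Ir k) n) = cong (⊗rL k) (sym (post-id n))
postR-resp-≐ αρ (⊗r r k) =
  ≋-to-≡ (post-≋ α (postR-ρ (⊗r r k))
          ≋∙ postR-α r k (switch Ir)
          ≋∙ ⊗rL-≋ (refl≋ {k = switch r}) (≋-sym (post-ρ k)))
postR-resp-≐ ααα (⊗r (⊗r (⊗r r k) m) n) =
  ≋-to-≡ (post-≋ α (postR-α (⊗r r k) m n)
          ≋∙ postR-α r k (⊗rL m n)
          ≋∙ ⊗rL-≋ (refl≋ {k = switch r}) (≋-sym (post-α k m n))
          ≋∙ ≋-sym (post-≋ (id ⊗ₘ α) (post-≋ α (⊗rL-≋ (postR-α r k m) (≡-to-≋ (post-id n)))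
                                      ≋∙ post-α (switch r) (⊗rL k m) n)))

-- Coherence of ψ and φ'

≐-setoid : (A B : Fma At) → Setoid 0ℓ 0ℓ
≐-setoid A B = record
  { Carrier       = A ⇒ B
  ; _≈_           = _≐_
  ; isEquivalence = record { refl = refl ; sym = ~_ ; trans = _∙_ }
  }

module ≐-Reasoning {At : Set} {A B : Fma At} = SetoidReasoning (≐-setoid A B)

≡-to-≐ : {f g : A ⇒ B} → f ≡ g → f ≐ g
≡-to-≐ refl = refl

⊗id-∘ : {g : B ⇒ C} {f : A ⇒ B} → (g ∘ f) ⊗ₘ id {A = D} ≐ (g ⊗ₘ id) ∘ (f ⊗ₘ id)
⊗id-∘ = (refl ⊗ rid) ∙ f⊗∘

id⊗-∘ : {g : B ⇒ C} {f : A ⇒ B} → id {A = D} ⊗ₘ (g ∘ f) ≐ (id ⊗ₘ g) ∘ (id ⊗ₘ f)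
id⊗-∘ = (rid ⊗ refl) ∙ f⊗∘

⊗-∘-⊗id : {f : A ⇒ B} {g : C ⇒ D} {h : A' ⇒ A} →
          (f ⊗ₘ g) ∘ (h ⊗ₘ id) ≐ (f ∘ h) ⊗ₘ g
⊗-∘-⊗id = (~ f⊗∘) ∙ (refl ⊗ lid)

⟦⟧ₘ-cong : {f g : A ⇒ B} (Γ : Cxt At) → f ≐ g → ⟦ f ∣ Γ ⟧ₘ ≐ ⟦ g ∣ Γ ⟧ₘ
⟦⟧ₘ-cong []      p = p
⟦⟧ₘ-cong (C ∷ Γ) p = ⟦⟧ₘ-cong Γ (p ⊗ refl)

⟦⟧ₘ-∘ : (g : B ⇒ C) (f : A ⇒ B) (Γ : Cxt At) → ⟦ g ∘ f ∣ Γ ⟧ₘ ≐ ⟦ g ∣ Γ ⟧ₘ ∘ ⟦ f ∣ Γ ⟧ₘ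
⟦⟧ₘ-∘ g f []      = refl
⟦⟧ₘ-∘ g f (C ∷ Γ) = ⟦⟧ₘ-cong Γ ⊗id-∘ ∙ ⟦⟧ₘ-∘ (g ⊗ₘ id) (f ⊗ₘ id) Γ

⟦⟧ₘ-id : (Γ : Cxt At) → ⟦ id {A = A} ∣ Γ ⟧ₘ ≐ id
⟦⟧ₘ-id []      = refl
⟦⟧ₘ-id (C ∷ Γ) = ⟦⟧ₘ-cong Γ f⊗id ∙ ⟦⟧ₘ-id Γ

⟦⟧ₘ-square : {f : A ⇒ B} {g : B ⇒ D} {h : A ⇒ C} {k : C ⇒ D} (Γ : Cxt At) →
             g ∘ f ≐ k ∘ h → ⟦ g ∣ Γ ⟧ₘ ∘ ⟦ f ∣ Γ ⟧ₘ ≐ ⟦ k ∣ Γ ⟧ₘ ∘ ⟦ h ∣ Γ ⟧ₘ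
⟦⟧ₘ-square {f = f} {g} {h} {k} Γ p = (~ ⟦⟧ₘ-∘ g f Γ) ∙ (⟦⟧ₘ-cong Γ p ∙ ⟦⟧ₘ-∘ k h Γ)

ψ-natˡ : (f : A ⇒ A') (B : Fma At) (Γ : Cxt At) →
         ψ A' B Γ ∘ ⟦ f ⊗ₘ id ∣ Γ ⟧ₘ ≐ (f ⊗ₘ id) ∘ ψ A B Γ
ψ-natˡ f B []      = (~ rid) ∙ (~ lid)
ψ-natˡ {A = A} {A' = A'} f B (C ∷ Γ) = begin
  (ψ A' (B ⊗ C) Γ ∘ ⟦ α ∣ Γ ⟧ₘ) ∘ ⟦ (f ⊗ₘ id) ⊗ₘ id ∣ Γ ⟧ₘ
    ≈⟨ ass ⟨
  ψ A' (B ⊗ C) Γ ∘ (⟦ α ∣ Γ ⟧ₘ ∘ ⟦ (f ⊗ₘ id) ⊗ₘ id ∣ Γ ⟧ₘ)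
    ≈⟨ refl ∘ ⟦⟧ₘ-square Γ ((~ nα) ∙ ((refl ⊗ f⊗id) ∘ refl)) ⟩
  ψ A' (B ⊗ C) Γ ∘ (⟦ f ⊗ₘ id ∣ Γ ⟧ₘ ∘ ⟦ α ∣ Γ ⟧ₘ)
    ≈⟨ ass ⟩
  (ψ A' (B ⊗ C) Γ ∘ ⟦ f ⊗ₘ id ∣ Γ ⟧ₘ) ∘ ⟦ α ∣ Γ ⟧ₘ
    ≈⟨ ψ-natˡ f (B ⊗ C) Γ ∘ refl ⟩
  ((f ⊗ₘ id) ∘ ψ A (B ⊗ C) Γ) ∘ ⟦ α ∣ Γ ⟧ₘ
    ≈⟨ ass ⟨
  (f ⊗ₘ id) ∘ (ψ A (B ⊗ C) Γ ∘ ⟦ α ∣ Γ ⟧ₘ)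
    ∎
  where open ≐-Reasoning

ψ-natʳ : (A : Fma At) (g : B ⇒ B') (Γ : Cxt At) →
         (id {A = A} ⊗ₘ ⟦ g ∣ Γ ⟧ₘ) ∘ ψ A B Γ ≐ ψ A B' Γ ∘ ⟦ id ⊗ₘ g ∣ Γ ⟧ₘ
ψ-natʳ A g []      = lid ∙ rid
ψ-natʳ {B = B} {B' = B'} A g (C ∷ Γ) = begin
  (id ⊗ₘ ⟦ g ⊗ₘ id ∣ Γ ⟧ₘ) ∘ (ψ A (B ⊗ C) Γ ∘ ⟦ α ∣ Γ ⟧ₘ)
    ≈⟨ ass ⟩
  ((id ⊗ₘ ⟦ g ⊗ₘ id ∣ Γ ⟧ₘ) ∘ ψ A (B ⊗ C) Γ) ∘ ⟦ α ∣ Γ ⟧ₘ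
    ≈⟨ ψ-natʳ A (g ⊗ₘ id) Γ ∘ refl ⟩
  (ψ A (B' ⊗ C) Γ ∘ ⟦ id ⊗ₘ (g ⊗ₘ id) ∣ Γ ⟧ₘ) ∘ ⟦ α ∣ Γ ⟧ₘ
    ≈⟨ ass ⟨
  ψ A (B' ⊗ C) Γ ∘ (⟦ id ⊗ₘ (g ⊗ₘ id) ∣ Γ ⟧ₘ ∘ ⟦ α ∣ Γ ⟧ₘ)
    ≈⟨ refl ∘ ⟦⟧ₘ-square Γ nα ⟩
  ψ A (B' ⊗ C) Γ ∘ (⟦ α ∣ Γ ⟧ₘ ∘ ⟦ (id ⊗ₘ g) ⊗ₘ id ∣ Γ ⟧ₘ)
    ≈⟨ ass ⟩
  (ψ A (B' ⊗ C) Γ ∘ ⟦ α ∣ Γ ⟧ₘ) ∘ ⟦ (id ⊗ₘ g) ⊗ₘ id ∣ Γ ⟧ₘ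
    ∎
  where open ≐-Reasoning

φ'-nat : (g : A ⇒ B) (Γ Δ : Cxt At) →
         φ' B Γ Δ ∘ ⟦ g ∣ Γ ++ Δ ⟧ₘ ≐ (⟦ g ∣ Γ ⟧ₘ ⊗ₘ id) ∘ φ' A Γ Δ
φ'-nat g (C ∷ Γ) Δ = φ'-nat (g ⊗ₘ id) Γ Δ
φ'-nat {A = A} {B = B} g [] Δ = begin
  (ψ B I Δ ∘ ⟦ ρ ∣ Δ ⟧ₘ) ∘ ⟦ g ∣ Δ ⟧ₘ
    ≈⟨ ass ⟨
  ψ B I Δ ∘ (⟦ ρ ∣ Δ ⟧ₘ ∘ ⟦ g ∣ Δ ⟧ₘ)
    ≈⟨ refl ∘ ⟦⟧ₘ-square Δ (~ nρ) ⟩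
  ψ B I Δ ∘ (⟦ g ⊗ₘ id ∣ Δ ⟧ₘ ∘ ⟦ ρ ∣ Δ ⟧ₘ)
    ≈⟨ ass ⟩
  (ψ B I Δ ∘ ⟦ g ⊗ₘ id ∣ Δ ⟧ₘ) ∘ ⟦ ρ ∣ Δ ⟧ₘ
    ≈⟨ ψ-natˡ g I Δ ∘ refl ⟩
  ((g ⊗ₘ id) ∘ ψ A I Δ) ∘ ⟦ ρ ∣ Δ ⟧ₘ
    ≈⟨ ass ⟨
  (g ⊗ₘ id) ∘ (ψ A I Δ ∘ ⟦ ρ ∣ Δ ⟧ₘ)
    ∎
  where open ≐-Reasoning

l∘ψ : (B : Fma At) (Δ : Cxt At) → l ∘ ψ I B Δ ≐ ⟦ l {A = B} ∣ Δ ⟧ₘ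
l∘ψ B []      = lid
l∘ψ B (C ∷ Δ) = begin
  l ∘ (ψ I (B ⊗ C) Δ ∘ ⟦ α ∣ Δ ⟧ₘ)   ≈⟨ ass ⟩
  (l ∘ ψ I (B ⊗ C) Δ) ∘ ⟦ α ∣ Δ ⟧ₘ   ≈⟨ l∘ψ (B ⊗ C) Δ ∘ refl ⟩
  ⟦ l ∣ Δ ⟧ₘ ∘ ⟦ α ∣ Δ ⟧ₘ            ≈⟨ ⟦⟧ₘ-∘ l α Δ ⟨
  ⟦ l ∘ α ∣ Δ ⟧ₘ                     ≈⟨ ⟦⟧ₘ-cong Δ lα ⟩
  ⟦ l ⊗ₘ id ∣ Δ ⟧ₘ                   ∎
  where open ≐-Reasoning

ψ-assoc : (X Y Z : Fma At) (Γ : Cxt At) →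
          (id ⊗ₘ ψ Y Z Γ) ∘ (ψ X (Y ⊗ Z) Γ ∘ ⟦ α ∣ Γ ⟧ₘ) ≐ α ∘ ψ (X ⊗ Y) Z Γ
ψ-assoc X Y Z []      = (f⊗id ∘ refl) ∙ ((~ rid) ∙ ((~ rid) ∙ (~ lid)))
ψ-assoc X Y Z (C ∷ Γ) = begin
  (id ⊗ₘ (ψ Y (Z ⊗ C) Γ ∘ ⟦ α ∣ Γ ⟧ₘ)) ∘ ((ψ X ((Y ⊗ Z) ⊗ C) Γ ∘ ⟦ α ∣ Γ ⟧ₘ) ∘ ⟦ α ⊗ₘ id ∣ Γ ⟧ₘ)
    ≈⟨ id⊗-∘ ∘ (~ ass) ⟩
  ((id ⊗ₘ ψ Y (Z ⊗ C) Γ) ∘ (id ⊗ₘ ⟦ α ∣ Γ ⟧ₘ)) ∘ (ψ X ((Y ⊗ Z) ⊗ C) Γ ∘ (⟦ α ∣ Γ ⟧ₘ ∘ ⟦ α ⊗ₘ id ∣ Γ ⟧ₘ))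
    ≈⟨ (~ ass) ∙ (refl ∘ ass) ⟩
  (id ⊗ₘ ψ Y (Z ⊗ C) Γ) ∘ (((id ⊗ₘ ⟦ α ∣ Γ ⟧ₘ) ∘ ψ X ((Y ⊗ Z) ⊗ C) Γ) ∘ (⟦ α ∣ Γ ⟧ₘ ∘ ⟦ α ⊗ₘ id ∣ Γ ⟧ₘ))
    ≈⟨ refl ∘ (ψ-natʳ X α Γ ∘ refl) ⟩
  (id ⊗ₘ ψ Y (Z ⊗ C) Γ) ∘ ((ψ X (Y ⊗ (Z ⊗ C)) Γ ∘ ⟦ id ⊗ₘ α ∣ Γ ⟧ₘ) ∘ (⟦ α ∣ Γ ⟧ₘ ∘ ⟦ α ⊗ₘ id ∣ Γ ⟧ₘ))
    ≈⟨ refl ∘ (~ ass) ⟩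
  (id ⊗ₘ ψ Y (Z ⊗ C) Γ) ∘ (ψ X (Y ⊗ (Z ⊗ C)) Γ ∘ (⟦ id ⊗ₘ α ∣ Γ ⟧ₘ ∘ (⟦ α ∣ Γ ⟧ₘ ∘ ⟦ α ⊗ₘ id ∣ Γ ⟧ₘ)))
    ≈⟨ refl ∘ (refl ∘ ((refl ∘ (~ ⟦⟧ₘ-∘ α (α ⊗ₘ id) Γ)) ∙ (~ ⟦⟧ₘ-∘ (id ⊗ₘ α) (α ∘ (α ⊗ₘ id)) Γ))) ⟩
  (id ⊗ₘ ψ Y (Z ⊗ C) Γ) ∘ (ψ X (Y ⊗ (Z ⊗ C)) Γ ∘ ⟦ (id ⊗ₘ α) ∘ (α ∘ (α ⊗ₘ id)) ∣ Γ ⟧ₘ)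
    ≈⟨ refl ∘ (refl ∘ (⟦⟧ₘ-cong Γ (~ ααα) ∙ ⟦⟧ₘ-∘ α α Γ)) ⟩
  (id ⊗ₘ ψ Y (Z ⊗ C) Γ) ∘ (ψ X (Y ⊗ (Z ⊗ C)) Γ ∘ (⟦ α ∣ Γ ⟧ₘ ∘ ⟦ α ∣ Γ ⟧ₘ))
    ≈⟨ (refl ∘ ass) ∙ ass ⟩
  ((id ⊗ₘ ψ Y (Z ⊗ C) Γ) ∘ (ψ X (Y ⊗ (Z ⊗ C)) Γ ∘ ⟦ α ∣ Γ ⟧ₘ)) ∘ ⟦ α ∣ Γ ⟧ₘ
    ≈⟨ ψ-assoc X Y (Z ⊗ C) Γ ∘ refl ⟩
  (α ∘ ψ (X ⊗ Y) (Z ⊗ C) Γ) ∘ ⟦ α ∣ Γ ⟧ₘ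
    ≈⟨ ass ⟨
  α ∘ (ψ (X ⊗ Y) (Z ⊗ C) Γ ∘ ⟦ α ∣ Γ ⟧ₘ)
    ∎
  where open ≐-Reasoning

ψ-φ' : (X Y : Fma At) (Γ Δ : Cxt At) →
       (id ⊗ₘ φ' Y Γ Δ) ∘ ψ X Y (Γ ++ Δ) ≐ α ∘ ((ψ X Y Γ ⊗ₘ id) ∘ φ' (X ⊗ Y) Γ Δ)
ψ-φ' X Y [] Δ = begin
  (id ⊗ₘ (ψ Y I Δ ∘ ⟦ ρ ∣ Δ ⟧ₘ)) ∘ ψ X Y Δ
    ≈⟨ id⊗-∘ ∘ refl ⟩
  ((id ⊗ₘ ψ Y I Δ) ∘ (id ⊗ₘ ⟦ ρ ∣ Δ ⟧ₘ)) ∘ ψ X Y Δ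
    ≈⟨ ass ⟨
  (id ⊗ₘ ψ Y I Δ) ∘ ((id ⊗ₘ ⟦ ρ ∣ Δ ⟧ₘ) ∘ ψ X Y Δ)
    ≈⟨ refl ∘ ψ-natʳ X ρ Δ ⟩
  (id ⊗ₘ ψ Y I Δ) ∘ (ψ X (Y ⊗ I) Δ ∘ ⟦ id ⊗ₘ ρ ∣ Δ ⟧ₘ)
    ≈⟨ refl ∘ (refl ∘ (⟦⟧ₘ-cong Δ (~ αρ) ∙ ⟦⟧ₘ-∘ α ρ Δ)) ⟩
  (id ⊗ₘ ψ Y I Δ) ∘ (ψ X (Y ⊗ I) Δ ∘ (⟦ α ∣ Δ ⟧ₘ ∘ ⟦ ρ ∣ Δ ⟧ₘ))
    ≈⟨ (refl ∘ ass) ∙ ass ⟩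
  ((id ⊗ₘ ψ Y I Δ) ∘ (ψ X (Y ⊗ I) Δ ∘ ⟦ α ∣ Δ ⟧ₘ)) ∘ ⟦ ρ ∣ Δ ⟧ₘ
    ≈⟨ ψ-assoc X Y I Δ ∘ refl ⟩
  (α ∘ ψ (X ⊗ Y) I Δ) ∘ ⟦ ρ ∣ Δ ⟧ₘ
    ≈⟨ (~ ass) ∙ (refl ∘ (rid ∙ ((~ f⊗id) ∘ refl))) ⟩
  α ∘ ((id ⊗ₘ id) ∘ (ψ (X ⊗ Y) I Δ ∘ ⟦ ρ ∣ Δ ⟧ₘ))
    ∎
  where open ≐-Reasoning
ψ-φ' X Y (C ∷ Γ) Δ = begin
  (id ⊗ₘ φ' (Y ⊗ C) Γ Δ) ∘ (ψ X (Y ⊗ C) (Γ ++ Δ) ∘ ⟦ α ∣ Γ ++ Δ ⟧ₘ)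
    ≈⟨ ass ⟩
  ((id ⊗ₘ φ' (Y ⊗ C) Γ Δ) ∘ ψ X (Y ⊗ C) (Γ ++ Δ)) ∘ ⟦ α ∣ Γ ++ Δ ⟧ₘ
    ≈⟨ ψ-φ' X (Y ⊗ C) Γ Δ ∘ refl ⟩
  (α ∘ ((ψ X (Y ⊗ C) Γ ⊗ₘ id) ∘ φ' (X ⊗ (Y ⊗ C)) Γ Δ)) ∘ ⟦ α ∣ Γ ++ Δ ⟧ₘ
    ≈⟨ (~ ass) ∙ (refl ∘ (~ ass)) ⟩
  α ∘ ((ψ X (Y ⊗ C) Γ ⊗ₘ id) ∘ (φ' (X ⊗ (Y ⊗ C)) Γ Δ ∘ ⟦ α ∣ Γ ++ Δ ⟧ₘ))
    ≈⟨ refl ∘ (refl ∘ φ'-nat α Γ Δ) ⟩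
  α ∘ ((ψ X (Y ⊗ C) Γ ⊗ₘ id) ∘ ((⟦ α ∣ Γ ⟧ₘ ⊗ₘ id) ∘ φ' ((X ⊗ Y) ⊗ C) Γ Δ))
    ≈⟨ refl ∘ (ass ∙ (⊗-∘-⊗id ∘ refl)) ⟩
  α ∘ (((ψ X (Y ⊗ C) Γ ∘ ⟦ α ∣ Γ ⟧ₘ) ⊗ₘ id) ∘ φ' ((X ⊗ Y) ⊗ C) Γ Δ)
    ∎
  where open ≐-Reasoning

castDom : (A : Fma At) → Γ ≡ Γ' → A ∣∣ Γ ⇒ B → A ∣∣ Γ' ⇒ B
castDom A refl f = f

castDom-∘ : (e : Γ ≡ Γ') (g : B ⇒ C) (f : A ∣∣ Γ ⇒ B) → castDom A e (g ∘ f) ≡ g ∘ castDom A e f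
castDom-∘ refl g f = refl

castDom-cong : (e : Γ ≡ Γ') {f g : A ∣∣ Γ ⇒ B} → f ≐ g → castDom A e f ≐ castDom A e g
castDom-cong refl p = p

castDom-∷ : (e : Γ ≡ Γ') (f : (A ⊗ C) ∣∣ Γ ⇒ B) → castDom A (cong (C ∷_) e) f ≡ castDom (A ⊗ C) e f
castDom-∷ refl f = refl

φ'-ρ : (A : Fma At) (Γ : Cxt At) → castDom A (++-identityʳ Γ) (φ' A Γ []) ≐ ρ
φ'-ρ A []      = ~ rid
φ'-ρ A (C ∷ Γ) = ≡-to-≐ (castDom-∷ (++-identityʳ Γ) (φ' (A ⊗ C) Γ [])) ∙ φ'-ρ (A ⊗ C) Γ

φ'-assoc : (X : Fma At) (Γ₁ Γ₂ Γ₃ : Cxt At) →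
           castDom X (sym (++-assoc Γ₁ Γ₂ Γ₃)) ((id ⊗ₘ φ' I Γ₂ Γ₃) ∘ φ' X Γ₁ (Γ₂ ++ Γ₃))
           ≐ α ∘ ((φ' X Γ₁ Γ₂ ⊗ₘ id) ∘ φ' X (Γ₁ ++ Γ₂) Γ₃)
φ'-assoc X (C ∷ Γ₁) Γ₂ Γ₃ =
  ≡-to-≐ (trans (cong (λ e → castDom X e ((id ⊗ₘ φ' I Γ₂ Γ₃) ∘ φ' (X ⊗ C) Γ₁ (Γ₂ ++ Γ₃)))
                      (sym-cong (++-assoc Γ₁ Γ₂ Γ₃)))
                (castDom-∷ (sym (++-assoc Γ₁ Γ₂ Γ₃)) _))
  ∙ φ'-assoc (X ⊗ C) Γ₁ Γ₂ Γ₃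
φ'-assoc X [] Γ₂ Γ₃ = begin
  (id ⊗ₘ φ' I Γ₂ Γ₃) ∘ (ψ X I (Γ₂ ++ Γ₃) ∘ ⟦ ρ ∣ Γ₂ ++ Γ₃ ⟧ₘ)
    ≈⟨ ass ⟩
  ((id ⊗ₘ φ' I Γ₂ Γ₃) ∘ ψ X I (Γ₂ ++ Γ₃)) ∘ ⟦ ρ ∣ Γ₂ ++ Γ₃ ⟧ₘ
    ≈⟨ ψ-φ' X I Γ₂ Γ₃ ∘ refl ⟩
  (α ∘ ((ψ X I Γ₂ ⊗ₘ id) ∘ φ' (X ⊗ I) Γ₂ Γ₃)) ∘ ⟦ ρ ∣ Γ₂ ++ Γ₃ ⟧ₘ
    ≈⟨ (~ ass) ∙ (refl ∘ (~ ass)) ⟩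
  α ∘ ((ψ X I Γ₂ ⊗ₘ id) ∘ (φ' (X ⊗ I) Γ₂ Γ₃ ∘ ⟦ ρ ∣ Γ₂ ++ Γ₃ ⟧ₘ))
    ≈⟨ refl ∘ (refl ∘ φ'-nat ρ Γ₂ Γ₃) ⟩
  α ∘ ((ψ X I Γ₂ ⊗ₘ id) ∘ ((⟦ ρ ∣ Γ₂ ⟧ₘ ⊗ₘ id) ∘ φ' X Γ₂ Γ₃))
    ≈⟨ refl ∘ (ass ∙ (⊗-∘-⊗id ∘ refl)) ⟩
  α ∘ (((ψ X I Γ₂ ∘ ⟦ ρ ∣ Γ₂ ⟧ₘ) ⊗ₘ id) ∘ φ' X Γ₂ Γ₃)
    ∎
  where open ≐-Reasoning

sound-castR : (e : Γ ≡ Γ') (r : T ∣ Γ ⊢R C) →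
              sound (embR (castR e r)) ≡ castDom (t (irr T)) e (sound (embR r))
sound-castR refl r = refl

sound-⊗rL : (k : S ∣ Γ ⊢L A) (n : ─ ∣ Δ ⊢L B) →
            sound (embL (⊗rL k n)) ≐ (sound (embL k) ⊗ₘ sound (embL n)) ∘ φ S Γ Δ
sound-⊗rL (switch r) n = refl
sound-⊗rL (Il k)     n = sound-⊗rL k n
sound-⊗rL (⊗l k)     n = sound-⊗rL k n
sound-⊗rL {Δ = Δ} (pass {Γ = Γ} {A = A} k) n = begin
  sound (embL (⊗rL k n)) ∘ ⟦ l ∣ Γ ++ Δ ⟧ₘ
    ≈⟨ sound-⊗rL k n ∘ refl ⟩
  ((sound (embL k) ⊗ₘ sound (embL n)) ∘ φ' A Γ Δ) ∘ ⟦ l ∣ Γ ++ Δ ⟧ₘ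
    ≈⟨ (~ ass) ∙ (refl ∘ φ'-nat l Γ Δ) ⟩
  (sound (embL k) ⊗ₘ sound (embL n)) ∘ ((⟦ l ∣ Γ ⟧ₘ ⊗ₘ id) ∘ φ' (I ⊗ A) Γ Δ)
    ≈⟨ ass ∙ (⊗-∘-⊗id ∘ refl) ⟩
  ((sound (embL k) ∘ ⟦ l ∣ Γ ⟧ₘ) ⊗ₘ sound (embL n)) ∘ φ' (I ⊗ A) Γ Δ
    ∎
  where open ≐-Reasoning

sound-post  : (f : A ⇒ B) (k : S ∣ Γ ⊢L A) → sound (embL (post f k)) ≐ f ∘ sound (embL k)
sound-postR : (f : A ⇒ B) (r : T ∣ Γ ⊢R A) → sound (embL (postR f r)) ≐ f ∘ sound (embR r)
sound-post f (pass k)   = (sound-post f k ∘ refl) ∙ (~ ass)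
sound-post f (switch r) = sound-postR f r
sound-post f (Il k)     = sound-post f k
sound-post f (⊗l k)     = sound-post f k
sound-postR id      r = rid
sound-postR (g ∘ f) r = sound-post g (postR f r) ∙ ((refl ∘ sound-postR f r) ∙ ass)
sound-postR (f ⊗ₘ g) (⊗r r k) =
  sound-⊗rL (postR f r) (post g k)
  ∙ ((((sound-postR f r ⊗ sound-post g k) ∙ f⊗∘) ∘ refl) ∙ (~ ass))
sound-postR l (⊗r {Δ = Δ} Ir k) = ~ (begin
  l ∘ ((id ⊗ₘ sound (embL k)) ∘ (ψ I I Δ ∘ ⟦ ρ ∣ Δ ⟧ₘ))
    ≈⟨ ass ∙ (nl ∘ refl) ⟩
  (sound (embL k) ∘ l) ∘ (ψ I I Δ ∘ ⟦ ρ ∣ Δ ⟧ₘ)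
    ≈⟨ (~ ass) ∙ (refl ∘ (ass ∙ (l∘ψ I Δ ∘ refl))) ⟩
  sound (embL k) ∘ (⟦ l ∣ Δ ⟧ₘ ∘ ⟦ ρ ∣ Δ ⟧ₘ)
    ≈⟨ refl ∘ ((~ ⟦⟧ₘ-∘ l ρ Δ) ∙ (⟦⟧ₘ-cong Δ lρ ∙ ⟦⟧ₘ-id Δ)) ⟩
  sound (embL k) ∘ id
    ≈⟨ lid ⟩
  sound (embL k)
    ∎)
  where open ≐-Reasoning
sound-postR {T = T} {Γ = Γ} ρ r = begin
  sound (embR (castR (++-identityʳ Γ) (⊗r r (switch Ir))))
    ≡⟨ sound-castR (++-identityʳ Γ) (⊗r r (switch Ir)) ⟩
  castDom (t (irr T)) (++-identityʳ Γ) ((sound (embR r) ⊗ₘ id) ∘ φ' (t (irr T)) Γ [])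
    ≡⟨ castDom-∘ (++-identityʳ Γ) (sound (embR r) ⊗ₘ id) (φ' (t (irr T)) Γ []) ⟩
  (sound (embR r) ⊗ₘ id) ∘ castDom (t (irr T)) (++-identityʳ Γ) (φ' (t (irr T)) Γ [])
    ≈⟨ (refl ∘ φ'-ρ (t (irr T)) Γ) ∙ nρ ⟩
  ρ ∘ sound (embR r)
    ∎
  where open ≐-Reasoning
sound-postR α (⊗r {T = T} {Δ = Γ₃} {B = C} (⊗r {Γ = Γ₁} {Δ = Γ₂} {A = A} {B = B} r k) n) = begin
  sound (embR (castR e (⊗r r (⊗rL k n))))
    ≡⟨ sound-castR e (⊗r r (⊗rL k n)) ⟩
  castDom X e ((s₁ ⊗ₘ sound (embL (⊗rL k n))) ∘ φ' X Γ₁ (Γ₂ ++ Γ₃))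
    ≈⟨ castDom-cong e ((refl ⊗ sound-⊗rL k n) ∘ refl) ⟩
  castDom X e ((s₁ ⊗ₘ ((s₂ ⊗ₘ s₃) ∘ φ' I Γ₂ Γ₃)) ∘ φ' X Γ₁ (Γ₂ ++ Γ₃))
    ≈⟨ castDom-cong e (((((~ lid) ⊗ refl) ∙ f⊗∘) ∘ refl) ∙ (~ ass)) ⟩
  castDom X e ((s₁ ⊗ₘ (s₂ ⊗ₘ s₃)) ∘ ((id ⊗ₘ φ' I Γ₂ Γ₃) ∘ φ' X Γ₁ (Γ₂ ++ Γ₃)))
    ≡⟨ castDom-∘ e (s₁ ⊗ₘ (s₂ ⊗ₘ s₃)) _ ⟩
  (s₁ ⊗ₘ (s₂ ⊗ₘ s₃)) ∘ castDom X e ((id ⊗ₘ φ' I Γ₂ Γ₃) ∘ φ' X Γ₁ (Γ₂ ++ Γ₃))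
    ≈⟨ refl ∘ φ'-assoc X Γ₁ Γ₂ Γ₃ ⟩
  (s₁ ⊗ₘ (s₂ ⊗ₘ s₃)) ∘ (α ∘ ((φ' X Γ₁ Γ₂ ⊗ₘ id) ∘ φ' X (Γ₁ ++ Γ₂) Γ₃))
    ≈⟨ ass ∙ (nα ∘ refl) ⟩
  (α ∘ ((s₁ ⊗ₘ s₂) ⊗ₘ s₃)) ∘ ((φ' X Γ₁ Γ₂ ⊗ₘ id) ∘ φ' X (Γ₁ ++ Γ₂) Γ₃)
    ≈⟨ (~ ass) ∙ (refl ∘ (ass ∙ (⊗-∘-⊗id ∘ refl))) ⟩
  α ∘ ((((s₁ ⊗ₘ s₂) ∘ φ' X Γ₁ Γ₂) ⊗ₘ s₃) ∘ φ' X (Γ₁ ++ Γ₂) Γ₃)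
    ∎
  where
  open ≐-Reasoning
  X : Fma _
  X = t (irr T)
  e : Γ₁ ++ (Γ₂ ++ Γ₃) ≡ (Γ₁ ++ Γ₂) ++ Γ₃
  e = sym (++-assoc Γ₁ Γ₂ Γ₃)
  s₁ : ⟦ irr T ∣ Γ₁ ⟧ ⇒ A
  s₁ = sound (embR r)
  s₂ : ⟦ ─ ∣ Γ₂ ⟧ ⇒ B
  s₂ = sound (embL k)
  s₃ : ⟦ ─ ∣ Γ₃ ⟧ ⇒ C
  s₃ = sound (embL n)

sound-idL : (A : Fma At) → sound (embL (idL A)) ≐ id
sound-idL (atom X) = refl
sound-idL I        = refl
sound-idL (A ⊗ B)  =
  sound-⊗rL (idL A) (pass (idL B))
  ∙ (((sound-idL A ⊗ ((sound-idL B ∘ refl) ∙ (~ rid))) ∘ ((~ rid) ∘ refl)) ∙ lαρ)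

-- Canonical derivations

base : (S : Stp At) → S ∣ [] ⊢L t S
base ─     = switch Ir
base (` A) = idL A

canL : S ∣ Γ₀ ⊢L B → (Γ : Cxt At) → S ∣ Γ₀ ++ Γ ⊢L B ∣∣ Γ
canL {Γ₀ = Γ₀} k []      = castL (sym (++-identityʳ Γ₀)) k
canL {Γ₀ = Γ₀} k (C ∷ Γ) = castL (++-assoc Γ₀ [ C ] Γ) (canL (⊗rL k (pass (idL C))) Γ)

can : (S : Stp At) (Γ : Cxt At) → S ∣ Γ ⊢L ⟦ S ∣ Γ ⟧
can S Γ = canL (base S) Γ

canL-≋ : {k : S ∣ Γ ⊢L B} {k' : S ∣ Γ' ⊢L B} (Δ : Cxt At) → k ≋ k' → canL k Δ ≋ canL k' Δ
canL-≋ Δ refl≋ = refl≋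

canL-pass : (k : ` A ∣ Γ₀ ⊢L B) (Γ : Cxt At) → canL (pass k) Γ ≋ pass (canL k Γ)
canL-pass {Γ₀ = Γ₀} k [] = castL-≋ _ _ ≋∙ pass-≋ (≋-sym (castL-≋ (sym (++-identityʳ Γ₀)) k))
canL-pass {Γ₀ = Γ₀} k (C ∷ Γ) =
  castL-≋ _ _ ≋∙ canL-pass (⊗rL k (pass (idL C))) Γ
  ≋∙ pass-≋ (≋-sym (castL-≋ (++-assoc Γ₀ [ C ] Γ) _))

canL-Il : (k : ─ ∣ Γ₀ ⊢L B) (Γ : Cxt At) → canL (Il k) Γ ≋ Il (canL k Γ)
canL-Il {Γ₀ = Γ₀} k [] = castL-≋ _ _ ≋∙ Il-≋ (≋-sym (castL-≋ (sym (++-identityʳ Γ₀)) k))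
canL-Il {Γ₀ = Γ₀} k (C ∷ Γ) =
  castL-≋ _ _ ≋∙ canL-Il (⊗rL k (pass (idL C))) Γ
  ≋∙ Il-≋ (≋-sym (castL-≋ (++-assoc Γ₀ [ C ] Γ) _))

canL-⊗l : (k : ` A ∣ B ∷ Γ₀ ⊢L D) (Γ : Cxt At) → canL (⊗l k) Γ ≋ ⊗l (canL k Γ)
canL-⊗l {B = B} {Γ₀ = Γ₀} k [] =
  castL-≋ _ _ ≋∙ ⊗l-≋ (≋-sym (castL-≋ (sym (++-identityʳ (B ∷ Γ₀))) k))
canL-⊗l {B = B} {Γ₀ = Γ₀} k (C ∷ Γ) =
  castL-≋ _ _ ≋∙ canL-⊗l (⊗rL k (pass (idL C))) Γ
  ≋∙ ⊗l-≋ (≋-sym (castL-≋ (++-assoc (B ∷ Γ₀) [ C ] Γ) _))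

post-⟦⟧ₘ-canL : (g : B ⇒ B') (k : S ∣ Γ₀ ⊢L B) (Γ : Cxt At) →
                post ⟦ g ∣ Γ ⟧ₘ (canL k Γ) ≋ canL (post g k) Γ
post-⟦⟧ₘ-canL {Γ₀ = Γ₀} g k [] =
  post-≋ g (castL-≋ (sym (++-identityʳ Γ₀)) k) ≋∙ ≋-sym (castL-≋ (sym (++-identityʳ Γ₀)) _)
post-⟦⟧ₘ-canL {Γ₀ = Γ₀} g k (C ∷ Γ) =
  post-≋ ⟦ g ⊗ₘ id ∣ Γ ⟧ₘ (castL-≋ (++-assoc Γ₀ [ C ] Γ) _)
  ≋∙ post-⟦⟧ₘ-canL (g ⊗ₘ id) (⊗rL k (pass (idL C))) Γ
  ≋∙ canL-≋ Γ (≡-to-≋ (trans (post-⊗rL g id k (pass (idL C))) (cong (⊗rL (post g k)) (post-id _))))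
  ≋∙ ≋-sym (castL-≋ (++-assoc Γ₀ [ C ] Γ) _)

post-ψ-canL : (k : S ∣ Γ₀ ⊢L B) (n : ─ ∣ Δ ⊢L D) (Γ : Cxt At) →
              post (ψ B D Γ) (canL (⊗rL k n) Γ) ≋ ⊗rL k (canL n Γ)
post-ψ-canL {Γ₀ = Γ₀} {Δ = Δ} k n [] =
  ≡-to-≋ (post-id _) ≋∙ castL-≋ (sym (++-identityʳ (Γ₀ ++ Δ))) (⊗rL k n)
  ≋∙ ⊗rL-≋ refl≋ (≋-sym (castL-≋ (sym (++-identityʳ Δ)) n))
post-ψ-canL {Γ₀ = Γ₀} {B = B} {Δ = Δ} {D = D} k n (C ∷ Γ) =
  ≡-to-≋ (post-∘ (ψ B (D ⊗ C) Γ) ⟦ α ∣ Γ ⟧ₘ (canL (⊗rL k n) (C ∷ Γ)))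
  ≋∙ post-≋ (ψ B (D ⊗ C) Γ) (post-≋ ⟦ α ∣ Γ ⟧ₘ (castL-≋ (++-assoc (Γ₀ ++ Δ) [ C ] Γ) _)
                              ≋∙ post-⟦⟧ₘ-canL α (⊗rL (⊗rL k n) (pass (idL C))) Γ
                              ≋∙ canL-≋ Γ (post-α k n (pass (idL C))))
  ≋∙ post-ψ-canL k (⊗rL n (pass (idL C))) Γ
  ≋∙ ⊗rL-≋ refl≋ (≋-sym (castL-≋ (++-assoc Δ [ C ] Γ) _))

post-φ'-canL : (k : S ∣ Γ₀ ⊢L B) (Γ Δ : Cxt At) →
               post (φ' B Γ Δ) (canL k (Γ ++ Δ)) ≋ ⊗rL (canL k Γ) (can ─ Δ)
post-φ'-canL {Γ₀ = Γ₀} {B = B} k [] Δ =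
  ≡-to-≋ (post-∘ (ψ B I Δ) ⟦ ρ ∣ Δ ⟧ₘ (canL k Δ))
  ≋∙ post-≋ (ψ B I Δ) (post-⟦⟧ₘ-canL ρ k Δ ≋∙ canL-≋ Δ (post-ρ k))
  ≋∙ post-ψ-canL k (switch Ir) Δ
  ≋∙ ⊗rL-≋ (≋-sym (castL-≋ (sym (++-identityʳ Γ₀)) k)) refl≋
post-φ'-canL {Γ₀ = Γ₀} {B = B} k (C ∷ Γ) Δ =
  post-≋ (φ' (B ⊗ C) Γ Δ) (castL-≋ (++-assoc Γ₀ [ C ] (Γ ++ Δ)) _)
  ≋∙ post-φ'-canL (⊗rL k (pass (idL C))) Γ Δ
  ≋∙ ⊗rL-≋ (≋-sym (castL-≋ (++-assoc Γ₀ [ C ] Γ) _)) refl≋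

post-⟦l⟧-can : (A : Fma At) (Γ : Cxt At) → post ⟦ l ∣ Γ ⟧ₘ (can ─ (A ∷ Γ)) ≡ pass (can (` A) Γ)
post-⟦l⟧-can A Γ = ≋-to-≡ (post-≋ ⟦ l ∣ Γ ⟧ₘ (castL-≋ (++-assoc [] [ A ] Γ) (canL (switch (⊗r Ir (pass (idL A)))) Γ))
                          ≋∙ post-⟦⟧ₘ-canL l (switch (⊗r Ir (pass (idL A)))) Γ
                          ≋∙ canL-pass (idL A) Γ)

can-I : (Γ : Cxt At) → can (` I) Γ ≡ Il (can ─ Γ)
can-I Γ = ≋-to-≡ (canL-Il (switch Ir) Γ)

can-⊗ : (A B : Fma At) (Γ : Cxt At) → can (` (A ⊗ B)) Γ ≡ ⊗l (can (` A) (B ∷ Γ))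
can-⊗ A B Γ = ≋-to-≡ (canL-⊗l (⊗rL (idL A) (pass (idL B))) Γ
                      ≋∙ ⊗l-≋ (≋-sym (castL-≋ (++-assoc [] [ B ] Γ) (canL (⊗rL (idL A) (pass (idL B))) Γ))))

post-sound-can  : (k : S ∣ Γ ⊢L C) → post (sound (embL k)) (can S Γ) ≡ k
postR-sound-can : (r : T ∣ Γ ⊢R C) → post (sound (embR r)) (can (irr T) Γ) ≡ switch r
post-sound-can (pass {Γ = Γ} {A = A} k) = begin
  post (sound (embL k) ∘ ⟦ l ∣ Γ ⟧ₘ) (can ─ (A ∷ Γ))      ≡⟨ post-∘ (sound (embL k)) ⟦ l ∣ Γ ⟧ₘ (can ─ (A ∷ Γ)) ⟩
  post (sound (embL k)) (post ⟦ l ∣ Γ ⟧ₘ (can ─ (A ∷ Γ))) ≡⟨ cong (post (sound (embL k))) (post-⟦l⟧-can A Γ) ⟩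
  pass (post (sound (embL k)) (can (` A) Γ))              ≡⟨ cong pass (post-sound-can k) ⟩
  pass k                                                  ∎
  where open ≡-Reasoning
post-sound-can (switch r) = postR-sound-can r
post-sound-can (Il {Γ = Γ} k) =
  trans (cong (post (sound (embL k))) (can-I Γ)) (cong Il (post-sound-can k))
post-sound-can (⊗l {Γ = Γ} {A = A} {B = B} k) =
  trans (cong (post (sound (embL k))) (can-⊗ A B Γ)) (cong ⊗l (post-sound-can k))
postR-sound-can ax = refl
postR-sound-can Ir = refl
postR-sound-can (⊗r {T = T} {Γ = Γ} {Δ = Δ} r k) = begin
  post ((sound (embR r) ⊗ₘ sound (embL k)) ∘ φ (irr T) Γ Δ) (can (irr T) (Γ ++ Δ))
    ≡⟨ post-∘ (sound (embR r) ⊗ₘ sound (embL k)) (φ (irr T) Γ Δ) (can (irr T) (Γ ++ Δ)) ⟩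
  post (sound (embR r) ⊗ₘ sound (embL k)) (post (φ (irr T) Γ Δ) (can (irr T) (Γ ++ Δ)))
    ≡⟨ cong (post (sound (embR r) ⊗ₘ sound (embL k))) (≋-to-≡ (post-φ'-canL (base (irr T)) Γ Δ)) ⟩
  post (sound (embR r) ⊗ₘ sound (embL k)) (⊗rL (can (irr T) Γ) (can ─ Δ))
    ≡⟨ post-⊗rL (sound (embR r)) (sound (embL k)) (can (irr T) Γ) (can ─ Δ) ⟩
  ⊗rL (post (sound (embR r)) (can (irr T) Γ)) (post (sound (embL k)) (can ─ Δ))
    ≡⟨ cong₂ ⊗rL (postR-sound-can r) (post-sound-can k) ⟩
  ⊗rL (switch r) k
    ∎
  where open ≡-Reasoning

theorem5p10 : {At : Set} {A C : Fma At} (f : A ⇒ C) →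
    Σ (` A ∣ [] ⊢L C) (λ h →
      (f ≐ sound (embL h)) × ((h' : ` A ∣ [] ⊢L C) → f ≐ sound (embL h') → h' ≡ h))
theorem5p10 {A = A} f =
  post f (idL A) ,
  ~ (sound-post f (idL A) ∙ ((refl ∘ sound-idL A) ∙ lid)) ,
  λ h f≐h → trans (sym (post-sound-can h)) (post-resp-≐ (~ f≐h) (idL A))
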